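{- Let $t$ be a term. (1) If $t$ is $\rhd\mathsf{shuf}$-normal then $|t|_0=\min\{|\pi|\mid\pi\text{ a derivation with subject }t\}$. (2) If $t$ is a value then $|t|_0=\min\{|\pi|\mid\pi\text{ a derivation with subject }t\}=0$.
   Context: Terms: $t ::= x \mid \lambda x.t \mid tu$ (up to $\alpha$); values $v ::= x \mid \lambda x.t$; $\mathrm{Fv}(t)$ free variables; $t\{v/x\}$ substitution. Root steps: ($\beta_v$) $(\lambda x.t)v \mapsto t\{v/x\}$, $v$ a value; ($\sigma_1$) $(\lambda x.t)us \mapsto (\lambda x.ts)u$ if $x\notin\mathrm{Fv}(s)$; ($\sigma_3$) $v((\lambda x.s)u)\mapsto(\lambda x.vs)u$ if $v$ a value, $x\notin\mathrm{Fv}(v)$. Balanced contexts $B ::= [\cdot] \mid (\lambda x.B)t \mid Bt \mid tB$; $\rhd\mathsf{shuf}$-reduction is the closure of the union of the root steps under balanced contexts; normal means no step applies. The $\rhd\mathsf{shuf}$-normal terms are exactly those generated by $n$ in the mutually inductive grammar $a ::= xv \mid xa \mid an$, $n ::= v \mid a \mid (\lambda x.n)a$, and on them $|\cdot|_0$ is defined by: $|v|_0=0$, $|xv|_0=1$, $|xa|_0=|a|_0+1$, $|an|_0=|a|_0+|n|_0+1$, $|(\lambda x.n)a|_0=|n|_0+|a|_0+1$. Types: positive types are finite multisets $[(P_1,Q_1),\dots,(P_n,Q_n)]$ of pairs of positive types ($\mathbf{0}$ empty, $\uplus$ union). Environments map variables to positive types (finitely many non-$\mathbf{0}$), combined pointwise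 by $\uplus$. Rules: (ax) $x\colon P\vdash x\colon P$; ($\lambda$) from $\Gamma_i,x\colon P_i\vdash t\colon Q_i$ ($1\le i\le n$, $n\ge0$) infer $\biguplus_i\Gamma_i\vdash\lambda x.t\colon[(P_1,Q_1),\dots,(P_n,Q_n)]$; ($@$) from $\Gamma\vdash t\colon[(P,Q)]$ and $\Delta\vdash u\colon P$ infer $\Gamma\uplus\Delta\vdash tu\colon Q$. A derivation has subject $t$ if its conclusion is of the form $\Gamma\vdash t\colon Q$; its size $|\pi|$ is the number of $@$ rules. -}

module Defs where

open import Data.Nat using (ℕ; zero; suc; _+_; _≤_; _≟_)
open import Data.List using (List; []; _∷_; _++_)
open import Data.Product using (Σ; _×_; _,_)
open import Relation.Binary.PropositionalEquality using (_≡_)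
open import Relation.Nullary using (¬_; yes; no)

-- Terms (de Bruijn indices, so terms are taken up to α-equivalence)

data Term : Set where
  var : ℕ → Term
  lam : Term → Term
  app : Term → Term → Term

data Value : Term → Set where
  vvar : ∀ x → Value (var x)
  vlam : ∀ t → Value (lam t)

ext : (ℕ → ℕ) → ℕ → ℕ
ext ρ zero    = zero
ext ρ (suc x) = suc (ρ x)

rename : (ℕ → ℕ) → Term → Term
rename ρ (var x)   = var (ρ x)
rename ρ (lam t)   = lam (rename (ext ρ) t)
rename ρ (app t u) = app (rename ρ t) (rename ρ u)

-- weakening: shift all free variables by one (used for the
-- side conditions x ∉ Fv(s), x ∉ Fv(v) of σ₁ and σ₃)
shift : Term → Term
shift = rename suc

exts : (ℕ → Term) → ℕ → Term
exts σ zero    = var zero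
exts σ (suc x) = shift (σ x)

sub : (ℕ → Term) → Term → Term
sub σ (var x)   = σ x
sub σ (lam t)   = lam (sub (exts σ) t)
sub σ (app t u) = app (sub σ t) (sub σ u)

-- t{v/x} where x is the bound variable (index 0)
_[_] : Term → Term → Term
t [ v ] = sub σ t
  where
  σ : ℕ → Term
  σ zero    = v
  σ (suc x) = var x

data _↦_ : Term → Term → Set where
  βv : ∀ {t v} → Value v → app (lam t) v ↦ (t [ v ])
  -- (λx.t)us ↦ (λx.ts)u ,  x ∉ Fv(s)
  σ₁ : ∀ {t u s} → app (app (lam t) u) s ↦ app (lam (app t (shift s))) u
  -- v((λx.s)u) ↦ (λx.vs)u ,  x ∉ Fv(v)
  σ₃ : ∀ {v s u} → Value v → app v (app (lam s) u) ↦ app (lam (app (shift v) s)) u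

data _▷shuf_ : Term → Term → Set where
  root   : ∀ {t t'} → t ↦ t' → t ▷shuf t'
  lamApp : ∀ {t t' u} → t ▷shuf t' → app (lam t) u ▷shuf app (lam t') u
  appL   : ∀ {t t' u} → t ▷shuf t' → app t u ▷shuf app t' u
  appR   : ∀ {t u u'} → u ▷shuf u' → app t u ▷shuf app t u'

Normal : Term → Set
Normal t = ∀ t' → ¬ (t ▷shuf t')

mutual
  data IsA : Term → Set where
    xv : ∀ x {v} → Value v → IsA (app (var x) v)
    xa : ∀ x {a} → IsA a → IsA (app (var x) a)
    an : ∀ {a n} → IsA a → IsN n → IsA (app a n)

  data IsN : Term → Set where
    nv : ∀ {v} → Value v → IsN v
    na : ∀ {a} → IsA a → IsN a
    nr : ∀ {n a} → IsN n → IsA a → IsN (app (lam n) a)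

mutual
  ∣_∣₀ᴬ : ∀ {t} → IsA t → ℕ
  ∣ xv x _ ∣₀ᴬ = 1
  ∣ xa x a ∣₀ᴬ = ∣ a ∣₀ᴬ + 1
  ∣ an a n ∣₀ᴬ = ∣ a ∣₀ᴬ + ∣ n ∣₀ + 1

  ∣_∣₀ : ∀ {t} → IsN t → ℕ
  ∣ nv _ ∣₀ = 0
  ∣ na a ∣₀ = ∣ a ∣₀ᴬ
  ∣ nr n a ∣₀ = ∣ n ∣₀ + ∣ a ∣₀ᴬ + 1

-- Positive types: finite multisets of pairs of positive types.
-- Represented by lists, with multiset equality _≈_ (permutation,
-- congruent in the elements).

data Pos : Set where
  mset : List (Pos × Pos) → Pos

𝟎 : Pos
𝟎 = mset []

_⊎ᵖ_ : Pos → Pos → Pos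
mset xs ⊎ᵖ mset ys = mset (xs ++ ys)

mutual
  data _≈_ : Pos → Pos → Set where
    mset≈ : ∀ {xs ys} → xs ≈ˡ ys → mset xs ≈ mset ys

  data _≈ˡ_ : List (Pos × Pos) → List (Pos × Pos) → Set where
    []≈    : [] ≈ˡ []
    cons≈  : ∀ {P P' Q Q' xs ys} → P ≈ P' → Q ≈ Q' → xs ≈ˡ ys →
             ((P , Q) ∷ xs) ≈ˡ ((P' , Q') ∷ ys)
    swap≈  : ∀ {x y xs} → (x ∷ y ∷ xs) ≈ˡ (y ∷ x ∷ xs)
    trans≈ : ∀ {xs ys zs} → xs ≈ˡ ys → ys ≈ˡ zs → xs ≈ˡ zs

Env : Set
Env = ℕ → Pos

∅ : Env
∅ _ = 𝟎

_⊎ₑ_ : Env → Env → Env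
(Γ ⊎ₑ Δ) x = Γ x ⊎ᵖ Δ x

⟨_∶_⟩ : ℕ → Pos → Env
⟨ x ∶ P ⟩ y with x ≟ y
... | yes _ = P
... | no  _ = 𝟎

tailₑ : Env → Env
tailₑ Δ x = Δ (suc x)

mutual
  data _⊢_∶_ : Env → Term → Pos → Set where
    ax  : ∀ x P → ⟨ x ∶ P ⟩ ⊢ var x ∶ P
    lamR : ∀ {Γ t ps} → Premises t Γ ps → Γ ⊢ lam t ∶ mset ps
    appR : ∀ {Γ Δ t u P P' Q} → Γ ⊢ t ∶ mset ((P , Q) ∷ []) →
           Δ ⊢ u ∶ P' → P ≈ P' → (Γ ⊎ₑ Δ) ⊢ app t u ∶ Q

  -- the list of premises of a (λ) rule with body t; the environment
  -- Δ of a premise is "Γᵢ, x : Pᵢ" with Pᵢ = Δ 0 and Γᵢ = tailₑ Δ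
  data Premises (t : Term) : Env → List (Pos × Pos) → Set where
    none : Premises t ∅ []
    more : ∀ {Δ Q Γ ps} → Δ ⊢ t ∶ Q → Premises t Γ ps →
           Premises t (tailₑ Δ ⊎ₑ Γ) ((Δ zero , Q) ∷ ps)

mutual
  size : ∀ {Γ t Q} → Γ ⊢ t ∶ Q → ℕ
  size (ax x P) = 0
  size (lamR ds) = sizeᴾ ds
  size (appR π ρ _) = size π + size ρ + 1

  sizeᴾ : ∀ {t Γ ps} → Premises t Γ ps → ℕ
  sizeᴾ none = 0
  sizeᴾ (more π ds) = size π + sizeᴾ ds

IsMinSize : Term → ℕ → Set
IsMinSize t m =
  (Σ Env λ Γ → Σ Pos λ Q → Σ (Γ ⊢ t ∶ Q) λ π → size π ≡ m)
  × (∀ Γ Q (π : Γ ⊢ t ∶ Q) → m ≤ size π)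

-- Lower bound: every application node of a normal term is the subject of an (@) rule in any
-- derivation; for a redex (λx.n)a the abstraction has a singleton type, so its (λ) rule has
-- exactly one premise, typing n.  Upper bound: values are typed at 𝟎 by an axiom or by a (λ)
-- rule with no premises, and an a-term, whose head is a variable, can be given any type Q by
-- choosing the type of the head axiom; so one (@) per application node suffices.
module Submission where

open import Defs
open import Data.Product using (Σ; _×_; _,_)
open import Data.List using ([]; _∷_)
open import Data.Nat using (ℕ; _+_; _≤_; z≤n)
open import Data.Nat.Properties using (+-identityʳ; +-mono-≤; +-monoˡ-≤; m≤n+m; m≤m+n; ≤-trans)
open import Relation.Binary.PropositionalEquality using (_≡_; refl; cong; cong₂; trans)

mutual
  ≈-refl : ∀ P → P ≈ P
  ≈-refl (mset xs) = mset≈ (≈ˡ-refl xs)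

  ≈ˡ-refl : ∀ xs → xs ≈ˡ xs
  ≈ˡ-refl [] = []≈
  ≈ˡ-refl ((P , Q) ∷ xs) = cons≈ (≈-refl P) (≈-refl Q) (≈ˡ-refl xs)

mutual
  ∣∣₀ᴬ≤size : ∀ {t} (p : IsA t) {Γ Q} (π : Γ ⊢ t ∶ Q) → ∣ p ∣₀ᴬ ≤ size π
  ∣∣₀ᴬ≤size (xv x v) (appR π ρ _) = m≤n+m 1 (size π + size ρ)
  ∣∣₀ᴬ≤size (xa x a) (appR π ρ _) =
    +-monoˡ-≤ 1 (≤-trans (∣∣₀ᴬ≤size a ρ) (m≤n+m (size ρ) (size π)))
  ∣∣₀ᴬ≤size (an a n) (appR π ρ _) = +-monoˡ-≤ 1 (+-mono-≤ (∣∣₀ᴬ≤size a π) (∣∣₀≤size n ρ))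

  ∣∣₀≤size : ∀ {t} (p : IsN t) {Γ Q} (π : Γ ⊢ t ∶ Q) → ∣ p ∣₀ ≤ size π
  ∣∣₀≤size (nv _) π = z≤n
  ∣∣₀≤size (na a) π = ∣∣₀ᴬ≤size a π
  ∣∣₀≤size (nr n a) (appR (lamR (more π none)) ρ _) =
    +-monoˡ-≤ 1 (+-mono-≤ (≤-trans (∣∣₀≤size n π) (m≤m+n (size π) 0)) (∣∣₀ᴬ≤size a ρ))

DerivationOfSize : Term → Pos → ℕ → Set
DerivationOfSize t Q m = Σ Env λ Γ → Σ (Γ ⊢ t ∶ Q) λ π → size π ≡ m

value-derivation-𝟎 : ∀ {v} → Value v → DerivationOfSize v 𝟎 0
value-derivation-𝟎 (vvar x) = _ , ax x 𝟎 , refl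
value-derivation-𝟎 (vlam t) = _ , lamR none , refl

var-app-derivation : ∀ x {u P m} Q → DerivationOfSize u P m →
                     DerivationOfSize (app (var x) u) Q (m + 1)
var-app-derivation x {P = P} Q (_ , ρ , ∣ρ∣≡m) =
  _ , appR (ax x (mset ((P , Q) ∷ []))) ρ (≈-refl P) , cong (_+ 1) ∣ρ∣≡m

mutual
  a-derivation : ∀ {t} (p : IsA t) Q → DerivationOfSize t Q ∣ p ∣₀ᴬ
  a-derivation (xv x v) Q = var-app-derivation x Q (value-derivation-𝟎 v)
  a-derivation (xa x a) Q = var-app-derivation x Q (a-derivation a 𝟎)
  a-derivation (an a n) Q with n-derivation n
  ... | P , _ , ρ , ∣ρ∣≡∣n∣ with a-derivation a (mset ((P , Q) ∷ []))
  ... | _ , π , ∣π∣≡∣a∣ =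
    _ , appR π ρ (≈-refl P) , cong (_+ 1) (cong₂ _+_ ∣π∣≡∣a∣ ∣ρ∣≡∣n∣)

  n-derivation : ∀ {t} (p : IsN t) → Σ Pos λ Q → DerivationOfSize t Q ∣ p ∣₀
  n-derivation (nv v) = 𝟎 , value-derivation-𝟎 v
  n-derivation (na a) = 𝟎 , a-derivation a 𝟎
  n-derivation (nr n a) with n-derivation n
  ... | Q , Δ , π , ∣π∣≡∣n∣ with a-derivation a (Δ 0)
  ... | _ , ρ , ∣ρ∣≡∣a∣ =
    Q , _ , appR (lamR (more π none)) ρ (≈-refl (Δ 0)) ,
    cong (_+ 1) (cong₂ _+_ (trans (+-identityʳ (size π)) ∣π∣≡∣n∣) ∣ρ∣≡∣a∣)

∣∣₀-isMinSize : ∀ {t} (p : IsN t) → IsMinSize t ∣ p ∣₀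
∣∣₀-isMinSize p with n-derivation p
... | Q , Γ , π , ∣π∣≡∣p∣ = (Γ , Q , π , ∣π∣≡∣p∣) , λ _ _ π′ → ∣∣₀≤size p π′

value-∣∣₀≡0 : ∀ {t} → Value t → (p : IsN t) → ∣ p ∣₀ ≡ 0
value-∣∣₀≡0 _        (nv _)  = refl
value-∣∣₀≡0 (vvar x) (na ())
value-∣∣₀≡0 (vlam t) (na ())

mainTheorem15 : ((t : Term) → Normal t → (p : IsN t) → IsMinSize t ∣ p ∣₀)
    × ((t : Term) → Value t → (p : IsN t) → IsMinSize t ∣ p ∣₀ × ∣ p ∣₀ ≡ 0)
mainTheorem15 =
  (λ _ _ p → ∣∣₀-isMinSize p) ,
  (λ _ v p → ∣∣₀-isMinSize p , value-∣∣₀≡0 v p)
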